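{- For arbitrary positive integers $m$ and $n$, $\mathscr G^{(m)}\cap\mathscr G^{(n)}=\mathscr G^{(\operatorname{lcm}(m,n))}$.
   Context: Let $\mathscr C$ be the ring of all sequences $\alpha:\mathbb N\to\mathbb Z$ with pointwise operations, $S$ the shift $(S\alpha)_n=\alpha_{n+1}$, and $\mathscr C_0$ the ideal of sequences $\alpha$ such that for every positive integer $n$, $\alpha_k\equiv0\pmod n$ for all but finitely many $k$. A polyadic number is a class modulo $\mathscr C_0$ of a sequence $\alpha$ with $\alpha-S\alpha\in\mathscr C_0$; these form a commutative ring $\mathscr P$ under the induced operations. For $n\in\mathbb N$, $\mathscr G^{(n)}=\{n\boldsymbol\alpha:\boldsymbol\alpha\in\mathscr P\}$. -}

module Defs where

open import Data.Nat as ℕ using (ℕ; _≥_)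
open import Data.Integer as ℤ using (ℤ; +_; _-_; _*_)
open import Data.Integer.Divisibility using (_∣_)
open import Data.Product using (Σ; ∃; _×_)

Seq : Set
Seq = ℕ → ℤ

S : Seq → Seq
S α k = α (ℕ.suc k)

_-ˢ_ : Seq → Seq → Seq
(α -ˢ β) k = α k - β k

InC₀ : Seq → Set
InC₀ α = (n : ℕ) → .{{_ : ℕ.NonZero n}} →
         ∃ λ N → (k : ℕ) → k ≥ N → (+ n) ∣ α k

-- representatives of polyadic numbers: sequences with α - Sα ∈ 𝒞₀
record PolyRep : Set where
  constructor mkPoly
  field
    seq   : Seq
    cauchy : InC₀ (seq -ˢ S seq)
open PolyRep public

_≈ᴾ_ : PolyRep → PolyRep → Set
a ≈ᴾ b = InC₀ (seq a -ˢ seq b)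

_·ˢ_ : ℕ → Seq → Seq
(n ·ˢ α) k = (+ n) * α k

-- membership in 𝒢⁽ⁿ⁾ = { n𝛂 : 𝛂 ∈ 𝒫 }
InG : ℕ → PolyRep → Set
InG n x = Σ PolyRep λ β → InC₀ (seq x -ˢ (n ·ˢ seq β))

module Submission where

-- Write g = gcd m n, m = g·m′, n = g·n′, so that lcm m n = m′·n = n′·m and
-- m′, n′ are coprime; choose integers a, b with a·m′ + b·n′ = 1.
-- If x ≡ m·β ≡ n·γ modulo 𝒞₀, then modulo 𝒞₀
--   x = a·m′·x + b·n′·x ≡ a·m′·n·γ + b·n′·m·β = lcm m n · (a·γ + b·β),
-- and a·γ + b·β is again polyadic.  Conversely, if x ≡ L·δ and m ∣ L, say
-- L = q·m, then x ≡ m·(q·δ).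

open import Defs
open import Data.Nat using (ℕ; NonZero)
open import Data.Nat.LCM using (lcm; m∣lcm[m,n]; n∣lcm[m,n])
open import Data.Product using (_×_; ∃₂; _,_)

import Data.Nat as ℕ
import Data.Nat.Properties as ℕ
import Data.Nat.Divisibility as ℕ
open import Data.Nat.DivMod using (_/_; *-/-assoc)
open import Data.Nat.GCD using (gcd; gcd[m,n]∣m; gcd[m,n]∣n; gcd[m,n]≢0; module Bézout)
open import Data.Nat.Coprimality using (Coprime; coprime-/gcd; coprime-Bézout)
open import Data.Integer using (ℤ; +_; _-_; _*_; _+_; -_; 1ℤ)
import Data.Integer.Properties as ℤ
open import Data.Integer.Divisibility using (_∣_)
import Data.Integer.Divisibility.Signed as Signed
open import Data.Integer.Tactic.RingSolver using (solve-∀)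
open import Data.Sum using (inj₁)
open import Relation.Binary.PropositionalEquality
open ≡-Reasoning

-- Integer divisibility (in the unsigned form used by 𝒞₀) is preserved by sums
-- and by multiples; the absolute value in its definition is not injective, so
-- the integers involved are passed explicitly.

∣-+ : ∀ {d} i j → d ∣ i → d ∣ j → d ∣ i + j
∣-+ {d} i j d∣i d∣j =
  Signed.∣⇒∣ᵤ (Signed.∣m∣n⇒∣m+n (Signed.∣ᵤ⇒∣ {d} {i} d∣i) (Signed.∣ᵤ⇒∣ {d} {j} d∣j))

∣-* : ∀ {d} c i → d ∣ i → d ∣ c * i
∣-* {d} c i d∣i = Signed.∣⇒∣ᵤ (Signed.∣n⇒∣m*n c (Signed.∣ᵤ⇒∣ {d} {i} d∣i))

InC₀-resp : ∀ {α β : Seq} → (∀ k → α k ≡ β k) → InC₀ α → InC₀ β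
InC₀-resp α≗β α∈C₀ n with α∈C₀ n
... | N , n∣α = N , λ k k≥N → subst (+ n ∣_) (α≗β k) (n∣α k k≥N)

InC₀-+ : ∀ (α β : Seq) → InC₀ α → InC₀ β → InC₀ (λ k → α k + β k)
InC₀-+ α β α∈C₀ β∈C₀ n with α∈C₀ n | β∈C₀ n
... | N₁ , n∣α | N₂ , n∣β = N₁ ℕ.⊔ N₂ , λ k k≥N →
  ∣-+ {+ n} (α k) (β k) (n∣α k (ℕ.≤-trans (ℕ.m≤m⊔n N₁ N₂) k≥N))
                        (n∣β k (ℕ.≤-trans (ℕ.m≤n⊔m N₁ N₂) k≥N))

InC₀-* : ∀ (c : ℤ) (α : Seq) → InC₀ α → InC₀ (λ k → c * α k)
InC₀-* c α α∈C₀ n with α∈C₀ n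
... | N , n∣α = N , λ k k≥N → ∣-* {+ n} c (α k) (n∣α k k≥N)

Δ : Seq → Seq
Δ α = α -ˢ S α

infixl 6 _⊕_
infixl 7 _⊙_

_⊕_ : PolyRep → PolyRep → PolyRep
β ⊕ γ = mkPoly (λ k → seq β k + seq γ k)
               (InC₀-resp (λ k → defect (seq β k) (seq β (ℕ.suc k)) (seq γ k) (seq γ (ℕ.suc k)))
                          (InC₀-+ (Δ (seq β)) (Δ (seq γ)) (cauchy β) (cauchy γ)))
  where
  defect : ∀ u u′ v v′ → (u - u′) + (v - v′) ≡ (u + v) - (u′ + v′)
  defect = solve-∀

_⊙_ : ℤ → PolyRep → PolyRep
c ⊙ β = mkPoly (λ k → c * seq β k)
               (InC₀-resp (λ k → defect c (seq β k) (seq β (ℕ.suc k)))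
                          (InC₀-* c (Δ (seq β)) (cauchy β)))
  where
  defect : ∀ c u u′ → c * (u - u′) ≡ c * u - c * u′
  defect = solve-∀

InG-divisor : ∀ {m L} → m ℕ.∣ L → (x : PolyRep) → InG L x → InG m x
InG-divisor {m} {L} (ℕ.divides q L≡q*m) x (δ , x≡Lδ) =
  (+ q ⊙ δ) , InC₀-resp (λ k → cong (_-_ (seq x k)) (regroup (seq δ k))) x≡Lδ
  where
  regroup : ∀ d → + L * d ≡ + m * (+ q * d)
  regroup d = begin
    + L * d           ≡⟨ cong (λ l → + l * d) L≡q*m ⟩
    + (q ℕ.* m) * d   ≡⟨ cong (_* d) (ℤ.pos-* q m) ⟩
    + q * + m * d     ≡⟨ swap (+ q) (+ m) d ⟩
    + m * (+ q * d)   ∎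
    where
    swap : ∀ u v w → u * v * w ≡ v * (u * w)
    swap = solve-∀

bézout-combination : ∀ {a b m n m′ n′ L : ℤ} → a * m′ + b * n′ ≡ 1ℤ →
                     L ≡ m′ * n → L ≡ n′ * m → ∀ x β γ →
                     a * m′ * (x - n * γ) + b * n′ * (x - m * β) ≡ x - L * (a * γ + b * β)
bézout-combination {a} {b} {m} {n} {m′} {n′} {L} bez L≡m′n L≡n′m x β γ = begin
  a * m′ * (x - n * γ) + b * n′ * (x - m * β)
    ≡⟨ expand a b m n m′ n′ x β γ ⟩
  (a * m′ + b * n′) * x - (m′ * n * (a * γ) + n′ * m * (b * β))
    ≡⟨ cong (λ u → u * x - (m′ * n * (a * γ) + n′ * m * (b * β))) bez ⟩
  1ℤ * x - (m′ * n * (a * γ) + n′ * m * (b * β))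
    ≡⟨ cong (λ u → 1ℤ * x - (u * (a * γ) + n′ * m * (b * β))) (sym L≡m′n) ⟩
  1ℤ * x - (L * (a * γ) + n′ * m * (b * β))
    ≡⟨ cong (λ u → 1ℤ * x - (L * (a * γ) + u * (b * β))) (sym L≡n′m) ⟩
  1ℤ * x - (L * (a * γ) + L * (b * β))
    ≡⟨ collect x L (a * γ) (b * β) ⟩
  x - L * (a * γ + b * β) ∎
  where
  expand : ∀ a b m n m′ n′ x β γ →
           a * m′ * (x - n * γ) + b * n′ * (x - m * β)
             ≡ (a * m′ + b * n′) * x - (m′ * n * (a * γ) + n′ * m * (b * β))
  expand = solve-∀
  collect : ∀ x L u v → 1ℤ * x - (L * u + L * v) ≡ x - L * (u + v)
  collect = solve-∀

record BézoutMultiple (m n L : ℕ) : Set where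
  field
    m′ n′  : ℕ
    a b    : ℤ
    bézout : a * + m′ + b * + n′ ≡ 1ℤ
    L≡m′n  : L ≡ m′ ℕ.* n
    L≡n′m  : L ≡ n′ ℕ.* m

InG-combine : ∀ {m n L} → BézoutMultiple m n L →
              (x : PolyRep) → InG m x → InG n x → InG L x
InG-combine {m} {n} {L} B x (β , x≡mβ) (γ , x≡nγ) =
  (a ⊙ γ ⊕ b ⊙ β) ,
  InC₀-resp (λ k → bézout-combination {a} {b} {+ m} {+ n} {+ m′} {+ n′} {+ L}
                      bézout (toℤ m′ n L≡m′n) (toℤ n′ m L≡n′m) (seq x k) (seq β k) (seq γ k))
            (InC₀-+ (λ k → a * + m′ * errorₙ k) (λ k → b * + n′ * errorₘ k)
                    (InC₀-* (a * + m′) errorₙ x≡nγ) (InC₀-* (b * + n′) errorₘ x≡mβ))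
  where
  open BézoutMultiple B
  errorₘ errorₙ : Seq
  errorₘ = seq x -ˢ (m ·ˢ seq β)
  errorₙ = seq x -ˢ (n ·ˢ seq γ)

  toℤ : ∀ i j → L ≡ i ℕ.* j → + L ≡ + i * + j
  toℤ i j L≡ij = trans (cong +_ L≡ij) (ℤ.pos-* i j)

-- The
-- library gives it in ℕ as 1 + y·n = x·m (or symmetrically); `bézoutℕ⇒ℤ`
-- carries this to ℤ and `move-across` subtracts y·n, yielding x·m − y·n = 1.

private
  bézoutℕ⇒ℤ : ∀ y n x m → 1 ℕ.+ y ℕ.* n ≡ x ℕ.* m → 1ℤ + + y * + n ≡ + x * + m
  bézoutℕ⇒ℤ y n x m eq = begin
    1ℤ + + y * + n        ≡⟨ cong (_+_ 1ℤ) (sym (ℤ.pos-* y n)) ⟩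
    1ℤ + + (y ℕ.* n)      ≡⟨ sym (ℤ.pos-+ 1 (y ℕ.* n)) ⟩
    + (1 ℕ.+ y ℕ.* n)     ≡⟨ cong +_ eq ⟩
    + (x ℕ.* m)           ≡⟨ ℤ.pos-* x m ⟩
    + x * + m             ∎

  move-across : ∀ u v p q → 1ℤ + u * v ≡ p * q → p * q + (- u) * v ≡ 1ℤ
  move-across u v p q 1+uv≡pq = begin
    p * q + (- u) * v           ≡⟨ cong (_+ (- u) * v) (sym 1+uv≡pq) ⟩
    1ℤ + u * v + (- u) * v      ≡⟨ drop u v ⟩
    1ℤ                          ∎
    where
    drop : ∀ u v → 1ℤ + u * v + (- u) * v ≡ 1ℤ
    drop = solve-∀

coprime-bézoutℤ : ∀ {m n} → Coprime m n → ∃₂ λ a b → a * + m + b * + n ≡ 1ℤ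
coprime-bézoutℤ {m} {n} m⊥n with coprime-Bézout m⊥n
... | Bézout.+- x y 1+yn≡xm =
  + x , - + y , move-across (+ y) (+ n) (+ x) (+ m) (bézoutℕ⇒ℤ y n x m 1+yn≡xm)
... | Bézout.-+ x y 1+xm≡yn =
  - + x , + y , trans (ℤ.+-comm (- + x * + m) (+ y * + n))
                      (move-across (+ x) (+ m) (+ y) (+ n) (bézoutℕ⇒ℤ x m y n 1+xm≡yn))

/-swap : ∀ {g} m n .{{_ : NonZero g}} → g ℕ.∣ m → g ℕ.∣ n → (m / g) ℕ.* n ≡ m ℕ.* (n / g)
/-swap {g} m n g∣m g∣n = begin
  (m / g) ℕ.* n     ≡⟨ ℕ.*-comm (m / g) n ⟩
  n ℕ.* (m / g)     ≡⟨ sym (*-/-assoc n g∣m) ⟩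
  n ℕ.* m / g       ≡⟨ cong (_/ g) (ℕ.*-comm n m) ⟩
  m ℕ.* n / g       ≡⟨ *-/-assoc m g∣n ⟩
  m ℕ.* (n / g)     ∎

-- lcm m n is a Bézout multiple of m and n: with g = gcd m n, the cofactors
-- m / g and n / g are coprime and lcm m n = m·(n / g) = (m / g)·n.

lcm-bézoutMultiple : ∀ m n .{{_ : NonZero m}} → BézoutMultiple m n (lcm m n)
lcm-bézoutMultiple m@(ℕ.suc _) n = fromCoefficients (coprime-bézoutℤ (coprime-/gcd m n))
  where
  instance
    gcd≢0 : NonZero (gcd m n)
    gcd≢0 = ℕ.≢-nonZero (gcd[m,n]≢0 m n (inj₁ λ ()))
  m′ n′ : ℕ
  m′ = m / gcd m n
  n′ = n / gcd m n
  fromCoefficients : ∃₂ (λ a b → a * + m′ + b * + n′ ≡ 1ℤ) → BézoutMultiple m n (lcm m n)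
  fromCoefficients (a , b , bézout) = record
    { m′ = m′ ; n′ = n′ ; a = a ; b = b ; bézout = bézout
    ; L≡m′n = sym (/-swap m n (gcd[m,n]∣m m n) (gcd[m,n]∣n m n))
    ; L≡n′m = ℕ.*-comm m n′
    }

mainTheorem8 : (m n : ℕ) → .{{_ : NonZero m}} → .{{_ : NonZero n}} → (x : PolyRep) →
                 ((InG m x × InG n x) → InG (lcm m n) x) × (InG (lcm m n) x → (InG m x × InG n x))
mainTheorem8 m n x =
    (λ (x∈Gm , x∈Gn) → InG-combine (lcm-bézoutMultiple m n) x x∈Gm x∈Gn)
  , (λ x∈Gl → InG-divisor (m∣lcm[m,n] m n) x x∈Gl , InG-divisor (n∣lcm[m,n] m n) x x∈Gl)
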